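{- Let $N$ be a phylogenetic network on $X$. If $N$ is leaf-reconstructible, then $N$ is edge-reconstructible.
   Context: A phylogenetic tree on a finite set $X$ is a tree with no degree-2 vertices whose leaves are bijectively labelled by $X$. A blob of a graph is a maximal 2-connected subgraph with at least two edges. A phylogenetic network on $X$ is a connected graph $N$ such that contracting each blob into a single vertex yields a phylogenetic tree on $X$. A pseudo-network on $X$ is a multigraph with no degree-2 vertices whose leaves are bijectively labelled by $X$. Two pseudo-networks are equivalent ($\sim$) if there is a graph isomorphism between them that is the identity on $X$. For a vertex $v$, $N_v$ is obtained from $N$ by deleting $v$ with its incident edges and suppressing resulting degree-2 vertices; a leaf-reconstruction of $N$ is a phylogenetic network $N'$ on $X$ with $V(N')=V(N)$ and $N'_x\sim N_x$ for all $x\in X$, and $N$ is leaf-reconstructible if every leaf-reconstruction is equivalent to $N$. For an edge $e$, $N_e$ is obtained from $N$ by deleting $e$ and suppressing resulting degree-2 vertices; an edge-reconstruction of $N$ is a phylogenetic network $N'$ on $X$ with $E(N')=E(N)$ (via a fixed bijection of edge sets) and $N'_e\sim N_e$ for all $e\in E(N)$, and $N$ is edge-reconstructible if every edge-reconstruction of $N$ is equivalent to $N$. -}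

module Defs where

open import Data.Nat using (ℕ; zero; suc; _+_; _≤_)
open import Data.Fin using (Fin; zero; suc; inject₁; fromℕ)
open import Data.Fin.Properties using (_≟_)
open import Data.Fin.Subset using (Subset; _∈_; _⊆_)
open import Data.Product using (Σ; ∃; ∃-syntax; _×_; _,_; proj₁)
open import Data.Sum using (_⊎_)
open import Data.Maybe using (Maybe; just; nothing)
open import Data.Unit using (⊤)
open import Data.Bool using (if_then_else_)
open import Relation.Binary.PropositionalEquality using (_≡_; _≢_)
open import Relation.Nullary using (¬_; does)
open import Function.Bundles using (_↔_; _⇔_; Inverse)
open import Relation.Binary.Construct.Closure.ReflexiveTransitive using (Star)

sumF : ∀ {n} → (Fin n → ℕ) → ℕ
sumF {zero}  f = 0
sumF {suc n} f = f zero + sumF (λ i → f (suc i))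

ind : ∀ {n} → Fin n → Fin n → ℕ
ind u v = if does (u ≟ v) then 1 else 0

-- Finite multigraphs (loops and parallel edges allowed) with vertices
-- Fin nV, edges Fin nE, each edge having two (unordered) endpoints,
-- and a labelling of some vertices by a label type L.

record MGraph (L : Set) : Set where
  field
    nV  : ℕ
    nE  : ℕ
    src : Fin nE → Fin nV
    tgt : Fin nE → Fin nV
    lab : L → Fin nV

open MGraph public

SameEnds : ∀ {n} → Fin n → Fin n → Fin n → Fin n → Set
SameEnds a b c d = (a ≡ c × b ≡ d) ⊎ (a ≡ d × b ≡ c)

module _ {L : Set} (G : MGraph L) where

  Joins : Fin (nE G) → Fin (nV G) → Fin (nV G) → Set
  Joins e u v = SameEnds (src G e) (tgt G e) u v

  Inc : Fin (nE G) → Fin (nV G) → Set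
  Inc e v = (src G e ≡ v) ⊎ (tgt G e ≡ v)

  -- degree (a loop contributes 2)
  deg : Fin (nV G) → ℕ
  deg v = sumF (λ e → ind (src G e) v + ind (tgt G e) v)

  Simple : Set
  Simple = (∀ e → src G e ≢ tgt G e)
         × (∀ e f → Joins e (src G f) (tgt G f) → e ≡ f)

  ReachIn : (Fin (nE G) → Set) → Fin (nV G) → Fin (nV G) → Set
  ReachIn P = Star (λ a b → ∃[ e ] (P e × Joins e a b))

  Connected : Set
  Connected = ∀ u v → ReachIn (λ _ → ⊤) u v

  -- cycles: closed walk v₀ e₀ v₁ … e_{k-1} v_k = v₀ (k ≥ 1) with
  -- pairwise distinct edges and pairwise distinct v₀ … v_{k-1}
  record Cycle : Set where
    field
      len   : ℕ
      vs    : Fin (suc (suc len)) → Fin (nV G)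
      es    : Fin (suc len) → Fin (nE G)
      closed : vs (fromℕ (suc len)) ≡ vs zero
      vs-inj : ∀ i j → vs (inject₁ i) ≡ vs (inject₁ j) → i ≡ j
      es-inj : ∀ i j → es i ≡ es j → i ≡ j
      step   : ∀ i → Joins (es i) (vs (inject₁ i)) (vs (suc i))

  -- leaves are vertices of degree at most 1 (degree 0 only occurs for
  -- the one-vertex tree)
  Leaf : Fin (nV G) → Set
  Leaf v = deg v ≤ 1

  LeafLabelled : Set
  LeafLabelled = (∀ x y → lab G x ≡ lab G y → x ≡ y)
               × (∀ v → Leaf v ⇔ (∃[ x ] lab G x ≡ v))

  IsSubgraph : Subset (nV G) → Subset (nE G) → Set
  IsSubgraph sv se = ∀ e → e ∈ se → (src G e ∈ sv) × (tgt G e ∈ sv)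

  ConnectedSub : Subset (nV G) → Subset (nE G) → Set
  ConnectedSub sv se = ∀ u v → u ∈ sv → v ∈ sv → ReachIn (λ e → e ∈ se) u v

  ConnectedSubMinus : Subset (nV G) → Subset (nE G) → Fin (nV G) → Set
  ConnectedSubMinus sv se w =
    ∀ u v → u ∈ sv → v ∈ sv → u ≢ w → v ≢ w →
      ReachIn (λ e → (e ∈ se) × ¬ Inc e w) u v

  TwoConnected : Subset (nV G) → Subset (nE G) → Set
  TwoConnected sv se =
      IsSubgraph sv se
    × (∃[ a ] ∃[ b ] ∃[ c ] (a ∈ sv × b ∈ sv × c ∈ sv × a ≢ b × a ≢ c × b ≢ c))
    × ConnectedSub sv se
    × (∀ w → w ∈ sv → ConnectedSubMinus sv se w)

  AtLeastTwoEdges : Subset (nE G) → Set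
  AtLeastTwoEdges se = ∃[ e ] ∃[ f ] (e ∈ se × f ∈ se × e ≢ f)

  Blob : Subset (nV G) → Subset (nE G) → Set
  Blob sv se =
      TwoConnected sv se
    × AtLeastTwoEdges se
    × (∀ sv' se' → sv ⊆ sv' → se ⊆ se' → TwoConnected sv' se' →
         AtLeastTwoEdges se' → (sv' ≡ sv) × (se' ≡ se))

  SameBlob : Fin (nV G) → Fin (nV G) → Set
  SameBlob u v = ∃[ sv ] ∃[ se ] (Blob sv se × u ∈ sv × v ∈ sv)

  EdgeInBlob : Fin (nE G) → Set
  EdgeInBlob e = ∃[ sv ] ∃[ se ] (Blob sv se × e ∈ se)

-- T is (a representative of) the graph obtained from G by contracting
-- each blob into a single vertex: vertices of T are the classes of the
-- equivalence generated by "lie in a common blob", edges of T are the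
-- edges of G lying in no blob.
record BlobContraction {L : Set} (G T : MGraph L) : Set where
  field
    c      : Fin (nV G) → Fin (nV T)
    c-surj : ∀ t → ∃[ v ] c v ≡ t
    c-ker  : ∀ u v → (c u ≡ c v) ⇔ Star (SameBlob G) u v
    d      : Fin (nE T) → Fin (nE G)
    d-inj  : ∀ f g → d f ≡ d g → f ≡ g
    d-img  : ∀ e → (∃[ f ] d f ≡ e) ⇔ (¬ EdgeInBlob G e)
    d-ends : ∀ f → SameEnds (src T f) (tgt T f) (c (src G (d f))) (c (tgt G (d f)))
    c-lab  : ∀ x → c (lab G x) ≡ lab T x

PhyloTree : {L : Set} → MGraph L → Set
PhyloTree T = (1 ≤ nV T) × Connected T × ¬ Cycle T
            × (∀ v → deg T v ≢ 2) × LeafLabelled T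

PhyloNet : {L : Set} → MGraph L → Set
PhyloNet N = Simple N × Connected N × LeafLabelled N
           × ∃[ T ] (BlobContraction N T × PhyloTree T)

record Equiv {L : Set} (G H : MGraph L) : Set where
  field
    φ     : Fin (nV G) ↔ Fin (nV H)
    ψ     : Fin (nE G) ↔ Fin (nE H)
    ends  : ∀ e → SameEnds (Inverse.to φ (src G e)) (Inverse.to φ (tgt G e))
                           (src H (Inverse.to ψ e)) (tgt H (Inverse.to ψ e))
    labs  : ∀ x → Inverse.to φ (lab G x) ≡ lab H x

record Suppressible {L : Set} (G : MGraph L) (w : Fin (nV G)) : Set where
  field
    e₁ e₂ : Fin (nE G)
    a b   : Fin (nV G)
    e₁≢e₂ : e₁ ≢ e₂
    j₁    : Joins G e₁ w a
    j₂    : Joins G e₂ w b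
    a≢w   : a ≢ w
    b≢w   : b ≢ w
    deg2  : deg G w ≡ 2
    unlab : ∀ y → lab G y ≢ w

-- H is obtained from G by suppressing w: delete w, e₁, e₂, add edge ab
record SuppressRes {L : Set} (G : MGraph L) (w : Fin (nV G))
                   (s : Suppressible G w) (H : MGraph L) : Set where
  open Suppressible s
  field
    φ     : Fin (nV H) → Fin (nV G)
    φ-inj : ∀ u v → φ u ≡ φ v → u ≡ v
    φ-img : ∀ u → (∃[ z ] φ z ≡ u) ⇔ (u ≢ w)
    ψ     : Fin (nE H) → Maybe (Fin (nE G))
    ψ-inj : ∀ f g → ψ f ≡ ψ g → f ≡ g
    ψ-img : ∀ e → (∃[ f ] ψ f ≡ just e) ⇔ ((e ≢ e₁) × (e ≢ e₂))
    ψ-new : ∃[ f ] ψ f ≡ nothing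
    ends-old : ∀ f e → ψ f ≡ just e →
                 (φ (src H f) ≡ src G e) × (φ (tgt H f) ≡ tgt G e)
    ends-new : ∀ f → ψ f ≡ nothing → SameEnds (φ (src H f)) (φ (tgt H f)) a b
    labs  : ∀ y → φ (lab H y) ≡ lab G y

SupStep : {L : Set} → MGraph L → MGraph L → Set
SupStep G H = ∃[ w ] Σ (Suppressible G w) (λ s → SuppressRes G w s H)

FullySuppressed : {L : Set} → MGraph L → Set
FullySuppressed G = ∀ w → ¬ Suppressible G w

Suppress : {L : Set} → MGraph L → MGraph L → Set
Suppress H P = Star SupStep H P × FullySuppressed P

_∖_ : (X : Set) → X → Set
_∖_ X x = Σ X (λ y → y ≢ x)

record LeafDel {k : ℕ} (G : MGraph (Fin k)) (x : Fin k)
               (H : MGraph (Fin k ∖ x)) : Set where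
  field
    φ     : Fin (nV H) → Fin (nV G)
    φ-inj : ∀ u v → φ u ≡ φ v → u ≡ v
    φ-img : ∀ u → (∃[ z ] φ z ≡ u) ⇔ (u ≢ lab G x)
    ψ     : Fin (nE H) → Fin (nE G)
    ψ-inj : ∀ f g → ψ f ≡ ψ g → f ≡ g
    ψ-img : ∀ e → (∃[ f ] ψ f ≡ e) ⇔ (¬ Inc G e (lab G x))
    ends  : ∀ f → (φ (src H f) ≡ src G (ψ f)) × (φ (tgt H f) ≡ tgt G (ψ f))
    labs  : ∀ y → φ (lab H y) ≡ lab G (proj₁ y)

record EdgeDel {L : Set} (G : MGraph L) (e : Fin (nE G)) (H : MGraph L) : Set where
  field
    φ     : Fin (nV H) ↔ Fin (nV G)
    ψ     : Fin (nE H) → Fin (nE G)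
    ψ-inj : ∀ f g → ψ f ≡ ψ g → f ≡ g
    ψ-img : ∀ e' → (∃[ f ] ψ f ≡ e') ⇔ (e' ≢ e)
    ends  : ∀ f → (Inverse.to φ (src H f) ≡ src G (ψ f))
                × (Inverse.to φ (tgt H f) ≡ tgt G (ψ f))
    labs  : ∀ y → Inverse.to φ (lab H y) ≡ lab G y

-- P is (a representative of) N_x : delete leaf x, suppress degree-2 vertices
IsLeafDeleted : {k : ℕ} → MGraph (Fin k) → (x : Fin k) → MGraph (Fin k ∖ x) → Set
IsLeafDeleted G x P = ∃[ H ] (LeafDel G x H × Suppress H P)

-- P is (a representative of) N_e : delete edge e, suppress degree-2 vertices
IsEdgeDeleted : {L : Set} → (G : MGraph L) → Fin (nE G) → MGraph L → Set
IsEdgeDeleted G e P = ∃[ H ] (EdgeDel G e H × Suppress H P)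

LeafReconstruction : {k : ℕ} → MGraph (Fin k) → MGraph (Fin k) → Set
LeafReconstruction N N' =
    PhyloNet N'
  × (nV N' ≡ nV N)
  × (∀ x → ∃[ P' ] ∃[ P ] (IsLeafDeleted N' x P' × IsLeafDeleted N x P × Equiv P' P))

LeafReconstructible : {k : ℕ} → MGraph (Fin k) → Set
LeafReconstructible N = ∀ N' → LeafReconstruction N N' → Equiv N' N

EdgeReconstruction : {k : ℕ} → (N N' : MGraph (Fin k)) → Fin (nE N) ↔ Fin (nE N') → Set
EdgeReconstruction N N' β =
    PhyloNet N'
  × (∀ e → ∃[ P' ] ∃[ P ] (IsEdgeDeleted N' (Inverse.to β e) P'
                           × IsEdgeDeleted N e P × Equiv P' P))

EdgeReconstructible : {k : ℕ} → MGraph (Fin k) → Set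
EdgeReconstructible N =
  ∀ N' (β : Fin (nE N) ↔ Fin (nE N')) → EdgeReconstruction N N' β → Equiv N' N

-- Every edge-reconstruction N′ of N is a leaf-reconstruction. Deleting an edge and then
-- suppressing s vertices removes s vertices and s + 1 edges; since N and N′ have equally many
-- edges and equivalent edge-decks, s is the same on both sides, so nV N′ = nV N. If x is a leaf
-- with pendant edge e, then x is isolated in N − e, suppression never touches it, and removing it
-- from N_e gives N_x. The deck of N′ at β e, being equivalent to N_e, also has x isolated, which in
-- the connected N′ forces β e to be the pendant edge of x there; so the decks at x agree too. A leaf
-- without an edge only occurs in the one-vertex network.

module Submission where

open import Defs
open import Data.Nat using (ℕ; zero; suc; pred; _+_; _≤_; z≤n; s≤s)
open import Data.Nat.Properties using (+-cancelʳ-≡; suc-injective; ≤-antisym; ≤-trans; m≤m+n; m≤n+m; +-mono-≤)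
open import Data.Fin using (Fin; zero; suc; punchIn; punchOut; fromℕ<)
open import Data.Fin.Properties as Fin using (_≟_; punchIn-injective; punchInᵢ≢i; punchOut-cong; punchOut-injective; punchIn-punchOut; punchOut-punchIn; injective⇒≤; any?)
open import Data.Fin.Permutation using (↔⇒≡)
open import Data.Product using (Σ; ∃; ∃-syntax; _×_; _,_; proj₁; proj₂)
open import Data.Sum using (_⊎_; inj₁; inj₂)
open import Data.Maybe using (Maybe; just; nothing)
open import Data.Empty using (⊥; ⊥-elim)
open import Relation.Binary.PropositionalEquality using (_≡_; _≢_; refl; sym; trans; cong; cong₂; subst; module ≡-Reasoning)
open import Relation.Nullary using (¬_; yes; no; Dec)
open import Relation.Nullary.Decidable using (_⊎-dec_)
open import Function using (_∘_)
open import Function.Bundles using (_↔_; _⇔_; Inverse; Injection; Equivalence; mk↔ₛ′; mk⇔)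
open import Function.Properties.Inverse using (↔-sym; ↔⇒↣)
open import Relation.Binary.Construct.Closure.ReflexiveTransitive using (Star; ε; _◅_)

private
  to-injective : ∀ {A B : Set} (φ : A ↔ B) {a b} → Inverse.to φ a ≡ Inverse.to φ b → a ≡ b
  to-injective φ = Injection.injective (↔⇒↣ φ)

  from-injective : ∀ {A B : Set} (φ : A ↔ B) {a b} → Inverse.from φ a ≡ Inverse.from φ b → a ≡ b
  from-injective φ = Injection.injective (↔⇒↣ (↔-sym φ))

punchIn′ : ∀ {n} (p : Fin n) → Fin (pred n) → Fin n
punchIn′ {suc n} p j = punchIn p j

punchOut′ : ∀ {n} (p : Fin n) {i : Fin n} → i ≢ p → Fin (pred n)
punchOut′ {suc n} p i≢p = punchOut (i≢p ∘ sym)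

punchIn′-injective : ∀ {n} (p : Fin n) {i j} → punchIn′ p i ≡ punchIn′ p j → i ≡ j
punchIn′-injective {suc n} p {i} {j} = punchIn-injective p i j

punchIn′≢p : ∀ {n} (p : Fin n) i → punchIn′ p i ≢ p
punchIn′≢p {suc n} = punchInᵢ≢i

punchIn′-punchOut′ : ∀ {n} (p : Fin n) {i} (i≢p : i ≢ p) → punchIn′ p (punchOut′ p i≢p) ≡ i
punchIn′-punchOut′ {suc n} p i≢p = punchIn-punchOut _

punchOut′-cong : ∀ {n} (p : Fin n) {i j} {i≢p : i ≢ p} {j≢p : j ≢ p} →
                 i ≡ j → punchOut′ p i≢p ≡ punchOut′ p j≢p
punchOut′-cong {suc n} p = punchOut-cong p

punchOut′-injective : ∀ {n} (p : Fin n) {i j} {i≢p : i ≢ p} {j≢p : j ≢ p} →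
                      punchOut′ p i≢p ≡ punchOut′ p j≢p → i ≡ j
punchOut′-injective {suc n} p {i≢p = i≢p} {j≢p} = punchOut-injective (i≢p ∘ sym) (j≢p ∘ sym)

punchOut′-punchIn′ : ∀ {n} (p : Fin n) {j} {i≢p : punchIn′ p j ≢ p} → punchOut′ p i≢p ≡ j
punchOut′-punchIn′ {suc n} p = trans (punchOut-cong p refl) (punchOut-punchIn p)

punchOut′≡⇒≡punchIn′ : ∀ {n} (p : Fin n) {i j} {i≢p : i ≢ p} →
                        punchOut′ p i≢p ≡ j → i ≡ punchIn′ p j
punchOut′≡⇒≡punchIn′ p {i≢p = i≢p} q = trans (sym (punchIn′-punchOut′ p i≢p)) (cong (punchIn′ p) q)

≡punchIn′⇒punchOut′≡ : ∀ {n} (p : Fin n) {i j} {i≢p : i ≢ p} →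
                        i ≡ punchIn′ p j → punchOut′ p i≢p ≡ j
≡punchIn′⇒punchOut′≡ p {j = j} q = trans (punchOut′-cong p q) (punchOut′-punchIn′ p {i≢p = punchIn′≢p p j})

Meets : ∀ {n} → Fin n → Fin n → Fin n → Set
Meets a b v = a ≡ v ⊎ b ≡ v

SameEnds-sym : ∀ {n} {a b c d : Fin n} → SameEnds a b c d → SameEnds c d a b
SameEnds-sym (inj₁ (refl , refl)) = inj₁ (refl , refl)
SameEnds-sym (inj₂ (refl , refl)) = inj₂ (refl , refl)

SameEnds⇒Meets : ∀ {n} {a b c d v : Fin n} → SameEnds a b c d → Meets c d v → Meets a b v
SameEnds⇒Meets (inj₁ (refl , refl)) m        = m
SameEnds⇒Meets (inj₂ (refl , refl)) (inj₁ q) = inj₂ q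
SameEnds⇒Meets (inj₂ (refl , refl)) (inj₂ q) = inj₁ q

SameEnds-substˡ : ∀ {n} {a b a′ b′ c d : Fin n} → a′ ≡ a → b′ ≡ b → SameEnds a b c d → SameEnds a′ b′ c d
SameEnds-substˡ refl refl s = s

SameEnds-map : ∀ {n m} (f : Fin n → Fin m) {a b c d} → SameEnds a b c d → SameEnds (f a) (f b) (f c) (f d)
SameEnds-map f (inj₁ (q , r)) = inj₁ (cong f q , cong f r)
SameEnds-map f (inj₂ (q , r)) = inj₂ (cong f q , cong f r)

SameEnds-punchOut′ : ∀ {n} (p : Fin n) {a b c d} {a≢p : a ≢ p} {b≢p : b ≢ p} {c≢p : c ≢ p} {d≢p : d ≢ p} →
                     SameEnds a b c d →
                     SameEnds (punchOut′ p a≢p) (punchOut′ p b≢p) (punchOut′ p c≢p) (punchOut′ p d≢p)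
SameEnds-punchOut′ p (inj₁ (q , r)) = inj₁ (punchOut′-cong p q , punchOut′-cong p r)
SameEnds-punchOut′ p (inj₂ (q , r)) = inj₂ (punchOut′-cong p q , punchOut′-cong p r)

Meets-map : ∀ {n m} (f : Fin n → Fin m) {a b v} → Meets a b v → Meets (f a) (f b) (f v)
Meets-map f (inj₁ q) = inj₁ (cong f q)
Meets-map f (inj₂ q) = inj₂ (cong f q)

Meets-subst : ∀ {n} {a b v a′ b′ v′ : Fin n} → a ≡ a′ → b ≡ b′ → v ≡ v′ → Meets a b v → Meets a′ b′ v′
Meets-subst refl refl refl m = m

Meets-injective : ∀ {n m} (f : Fin n → Fin m) → (∀ {u u′} → f u ≡ f u′ → u ≡ u′) →
                  ∀ {a b v v′} → f v ≡ v′ → Meets (f a) (f b) v′ → Meets a b v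
Meets-injective f f-inj fv≡v′ (inj₁ q) = inj₁ (f-inj (trans q (sym fv≡v′)))
Meets-injective f f-inj fv≡v′ (inj₂ q) = inj₂ (f-inj (trans q (sym fv≡v′)))

Joins⇒Inc : ∀ {L} (G : MGraph L) {e a b} → Joins G e a b → Inc G e a
Joins⇒Inc G (inj₁ (q , _)) = inj₁ q
Joins⇒Inc G (inj₂ (_ , q)) = inj₂ q

Inc? : ∀ {L} (G : MGraph L) e v → Dec (Inc G e v)
Inc? G e v = (src G e ≟ v) ⊎-dec (tgt G e ≟ v)

sumF-cong : ∀ {n} {f g : Fin n → ℕ} → (∀ i → f i ≡ g i) → sumF f ≡ sumF g
sumF-cong {zero}  h = refl
sumF-cong {suc n} h = cong₂ _+_ (h zero) (sumF-cong (h ∘ suc))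

sumF-pos : ∀ {n} (g : Fin n → ℕ) i → 1 ≤ g i → 1 ≤ sumF g
sumF-pos g zero    h = ≤-trans h (m≤m+n _ _)
sumF-pos g (suc i) h = ≤-trans (sumF-pos (g ∘ suc) i h) (m≤n+m _ _)

sumF-two-pos : ∀ {n} (g : Fin n → ℕ) i j → i ≢ j → 1 ≤ g i → 1 ≤ g j → 2 ≤ sumF g
sumF-two-pos g zero    zero    i≢j _  _  = ⊥-elim (i≢j refl)
sumF-two-pos g zero    (suc j) _   hi hj = +-mono-≤ hi (sumF-pos (g ∘ suc) j hj)
sumF-two-pos g (suc i) zero    _   hi hj = +-mono-≤ hj (sumF-pos (g ∘ suc) i hi)
sumF-two-pos g (suc i) (suc j) i≢j hi hj =
  ≤-trans (sumF-two-pos (g ∘ suc) i j (i≢j ∘ cong suc) hi hj) (m≤n+m _ _)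

ind-cong : ∀ {n m} {a b : Fin n} {c d : Fin m} → (a ≡ b → c ≡ d) → (c ≡ d → a ≡ b) → ind a b ≡ ind c d
ind-cong {a = a} {b} {c} {d} f g with a ≟ b | c ≟ d
... | yes _ | yes _ = refl
... | no _  | no _  = refl
... | yes p | no q  = ⊥-elim (q (f p))
... | no p  | yes q = ⊥-elim (p (g q))

ind-refl : ∀ {n} {a b : Fin n} → a ≡ b → 1 ≤ ind a b
ind-refl {a = a} {b} a≡b with a ≟ b
... | yes _   = s≤s z≤n
... | no a≢b = ⊥-elim (a≢b a≡b)

Inc⇒1≤ : ∀ {L} (G : MGraph L) {e v} → Inc G e v → 1 ≤ ind (src G e) v + ind (tgt G e) v
Inc⇒1≤ G (inj₁ q) = ≤-trans (ind-refl q) (m≤m+n _ _)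
Inc⇒1≤ G (inj₂ q) = ≤-trans (ind-refl q) (m≤n+m _ _)

Leaf-Inc-unique : ∀ {L} (G : MGraph L) {v} → Leaf G v → ∀ {e f} → Inc G e v → Inc G f v → e ≡ f
Leaf-Inc-unique G {v} leaf {e} {f} ie if with e ≟ f
... | yes e≡f = e≡f
... | no e≢f with ≤-trans (sumF-two-pos (λ e → ind (src G e) v + ind (tgt G e) v) e f e≢f
                             (Inc⇒1≤ G ie) (Inc⇒1≤ G if)) leaf
... | s≤s ()

record IsolatedLabel {k : ℕ} (G : MGraph (Fin k)) (x : Fin k) : Set where
  field
    isolated : ∀ e → ¬ Inc G e (lab G x)
    unshared : ∀ y → y ≢ x → lab G y ≢ lab G x
open IsolatedLabel

removeIsolated : ∀ {k} (G : MGraph (Fin k)) (x : Fin k) → IsolatedLabel G x → MGraph (Fin k ∖ x)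
removeIsolated G x I = record
  { nV  = pred (nV G)
  ; nE  = nE G
  ; src = λ e → punchOut′ (lab G x) (isolated I e ∘ inj₁)
  ; tgt = λ e → punchOut′ (lab G x) (isolated I e ∘ inj₂)
  ; lab = λ (y , y≢x) → punchOut′ (lab G x) (unshared I y y≢x)
  }

removeIsolated-LeafDel : ∀ {k} (G : MGraph (Fin k)) (x : Fin k) (I : IsolatedLabel G x) →
                         LeafDel G x (removeIsolated G x I)
removeIsolated-LeafDel G x I = record
  { φ     = punchIn′ p
  ; φ-inj = λ _ _ → punchIn′-injective p
  ; φ-img = λ u → mk⇔ (λ (z , q) r → punchIn′≢p p z (trans q r))
                      (λ u≢p → punchOut′ p u≢p , punchIn′-punchOut′ p u≢p)
  ; ψ     = λ f → f
  ; ψ-inj = λ _ _ q → q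
  ; ψ-img = λ e → mk⇔ (λ _ → isolated I e) (λ _ → e , refl)
  ; ends  = λ f → punchIn′-punchOut′ p _ , punchIn′-punchOut′ p _
  ; labs  = λ y → punchIn′-punchOut′ p _
  }
  where p = lab G x

deg-removeIsolated : ∀ {k} (G : MGraph (Fin k)) (x : Fin k) (I : IsolatedLabel G x) w →
                     deg (removeIsolated G x I) w ≡ deg G (punchIn′ (lab G x) w)
deg-removeIsolated G x I w = sumF-cong {nE G} λ e → cong₂ _+_ (ind-punchIn′ _) (ind-punchIn′ _)
  where
  p = lab G x
  ind-punchIn′ : ∀ {u} (u≢p : u ≢ p) → ind (punchOut′ p u≢p) w ≡ ind u (punchIn′ p w)
  ind-punchIn′ _ = ind-cong (punchOut′≡⇒≡punchIn′ p) (≡punchIn′⇒punchOut′≡ p)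

FullySuppressed-removeIsolated : ∀ {k} (G : MGraph (Fin k)) (x : Fin k) (I : IsolatedLabel G x) →
                                 FullySuppressed G → FullySuppressed (removeIsolated G x I)
FullySuppressed-removeIsolated G x I fs w s = fs (punchIn′ p w) record
  { e₁    = S.e₁
  ; e₂    = S.e₂
  ; a     = punchIn′ p S.a
  ; b     = punchIn′ p S.b
  ; e₁≢e₂ = S.e₁≢e₂
  ; j₁    = lift S.j₁
  ; j₂    = lift S.j₂
  ; a≢w   = S.a≢w ∘ punchIn′-injective p
  ; b≢w   = S.b≢w ∘ punchIn′-injective p
  ; deg2  = trans (sym (deg-removeIsolated G x I w)) S.deg2
  ; unlab = unlab
  }
  where
  p = lab G x
  module S = Suppressible s
  lift : ∀ {e c d} → Joins (removeIsolated G x I) e c d → Joins G e (punchIn′ p c) (punchIn′ p d)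
  lift j = SameEnds-substˡ (sym (punchIn′-punchOut′ p _)) (sym (punchIn′-punchOut′ p _))
                           (SameEnds-map (punchIn′ p) j)
  unlab : ∀ y → lab G y ≢ punchIn′ p w
  unlab y q with y ≟ x
  ... | yes refl = punchIn′≢p p w (sym q)
  ... | no y≢x   = S.unlab (y , y≢x) (≡punchIn′⇒punchOut′≡ p q)

isolated-Equiv : ∀ {k} {P′ P : MGraph (Fin k)} (x : Fin k) → Equiv P′ P →
                 (∀ e → ¬ Inc P e (lab P x)) → ∀ e → ¬ Inc P′ e (lab P′ x)
isolated-Equiv x E isol e inc =
  isol (Inverse.to E.ψ e)
       (SameEnds⇒Meets (SameEnds-sym (E.ends e)) (Meets-subst refl refl (E.labs x) (Meets-map (Inverse.to E.φ) inc)))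
  where module E = Equiv E

Equiv-removeIsolated : ∀ {k} {P′ P : MGraph (Fin k)} (x : Fin k) (I′ : IsolatedLabel P′ x) (I : IsolatedLabel P x) →
                       Equiv P′ P → Equiv (removeIsolated P′ x I′) (removeIsolated P x I)
Equiv-removeIsolated {P′ = P′} {P} x I′ I E = record
  { φ    = mk↔ₛ′ to′ from′ to′-from′ from′-to′
  ; ψ    = E.ψ
  ; ends = λ e → SameEnds-punchOut′ p (SameEnds-substˡ (to-punchIn′ _) (to-punchIn′ _) (E.ends e))
  ; labs = λ (y , _) → punchOut′-cong p (trans (to-punchIn′ _) (E.labs y))
  }
  where
  module E = Equiv E
  p′ = lab P′ x
  p  = lab P x
  to   = Inverse.to E.φ
  from = Inverse.from E.φ
  to-punchIn′ : ∀ {u} (u≢p′ : u ≢ p′) → to (punchIn′ p′ (punchOut′ p′ u≢p′)) ≡ to u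
  to-punchIn′ u≢p′ = cong to (punchIn′-punchOut′ p′ u≢p′)
  from-p : from p ≡ p′
  from-p = trans (cong from (sym (E.labs x))) (Inverse.strictlyInverseʳ E.φ p′)
  to′ : Fin (pred (nV P′)) → Fin (pred (nV P))
  to′ z = punchOut′ p {to (punchIn′ p′ z)}
            (punchIn′≢p p′ z ∘ to-injective E.φ ∘ λ q → trans q (sym (E.labs x)))
  from′ : Fin (pred (nV P)) → Fin (pred (nV P′))
  from′ z = punchOut′ p′ {from (punchIn′ p z)}
              (punchIn′≢p p z ∘ from-injective E.φ ∘ λ q → trans q (sym from-p))
  to′-from′ : ∀ z → to′ (from′ z) ≡ z
  to′-from′ z = ≡punchIn′⇒punchOut′≡ p
    (trans (cong to (punchIn′-punchOut′ p′ _)) (Inverse.strictlyInverseˡ E.φ (punchIn′ p z)))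
  from′-to′ : ∀ z → from′ (to′ z) ≡ z
  from′-to′ z = ≡punchIn′⇒punchOut′≡ p′
    (trans (cong from (punchIn′-punchOut′ p _)) (Inverse.strictlyInverseʳ E.φ (punchIn′ p′ z)))

-- Suppressing a degree-2 vertex commutes with removing an isolated labelled vertex

module _ {k : ℕ} {G G₂ : MGraph (Fin k)} (x : Fin k) {w : Fin (nV G)}
         (s : Suppressible G w) (r : SuppressRes G w s G₂) where

  private
    module S = Suppressible s
    module R = SuppressRes r
    p  = lab G x
    p₂ = lab G₂ x

    φ-Meets : ∀ {a b} → Meets (R.φ a) (R.φ b) p → Meets a b p₂
    φ-Meets = Meets-injective R.φ (R.φ-inj _ _) (R.labs x)

    oldEdge-Inc : ∀ {f e} → R.ψ f ≡ just e → Inc G e p → Inc G₂ f p₂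
    oldEdge-Inc ψf≡e inc = φ-Meets (Meets-subst (sym (proj₁ (R.ends-old _ _ ψf≡e)))
                                                (sym (proj₂ (R.ends-old _ _ ψf≡e))) refl inc)

    Inc-oldEdge : ∀ {f e} → R.ψ f ≡ just e → Inc G₂ f p₂ → Inc G e p
    Inc-oldEdge ψf≡e inc = Meets-subst (proj₁ (R.ends-old _ _ ψf≡e)) (proj₂ (R.ends-old _ _ ψf≡e))
                                       (R.labs x) (Meets-map R.φ inc)

    newEdge : Fin (nE G₂)
    newEdge = proj₁ R.ψ-new

    newEdge-Inc : Meets S.a S.b p → Inc G₂ newEdge p₂
    newEdge-Inc m = φ-Meets (SameEnds⇒Meets (R.ends-new _ (proj₂ R.ψ-new)) m)

    Inc-newEdge : ∀ {f} → R.ψ f ≡ nothing → Inc G₂ f p₂ → Meets S.a S.b p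
    Inc-newEdge ψf≡- inc =
      SameEnds⇒Meets (SameEnds-sym (R.ends-new _ ψf≡-)) (Meets-subst refl refl (R.labs x) (Meets-map R.φ inc))

    w≢p : w ≢ p
    w≢p = S.unlab x ∘ sym

  IsolatedLabel-suppress : IsolatedLabel G x → IsolatedLabel G₂ x
  IsolatedLabel-suppress I = record { isolated = isolated₂ ; unshared = unshared₂ }
    where
    isolated₂ : ∀ f → ¬ Inc G₂ f p₂
    isolated₂ f inc with R.ψ f in ψf
    ... | just e  = isolated I e (Inc-oldEdge ψf inc)
    ... | nothing with Inc-newEdge ψf inc
    ...   | inj₁ a≡p = isolated I S.e₁ (SameEnds⇒Meets S.j₁ (inj₂ a≡p))
    ...   | inj₂ b≡p = isolated I S.e₂ (SameEnds⇒Meets S.j₂ (inj₂ b≡p))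
    unshared₂ : ∀ y → y ≢ x → lab G₂ y ≢ p₂
    unshared₂ y y≢x q = unshared I y y≢x (trans (sym (R.labs y)) (trans (cong R.φ q) (R.labs x)))

  isolated-unsuppress : (∀ f → ¬ Inc G₂ f p₂) → ∀ e → ¬ Inc G e p
  isolated-unsuppress isol₂ e inc with e ≟ S.e₁ | e ≟ S.e₂
  ... | yes refl | _ with SameEnds⇒Meets (SameEnds-sym S.j₁) inc
  ...   | inj₁ w≡p = w≢p w≡p
  ...   | inj₂ a≡p = isol₂ newEdge (newEdge-Inc (inj₁ a≡p))
  isolated-unsuppress isol₂ e inc | no _ | yes refl with SameEnds⇒Meets (SameEnds-sym S.j₂) inc
  ...   | inj₁ w≡p = w≢p w≡p
  ...   | inj₂ b≡p = isol₂ newEdge (newEdge-Inc (inj₂ b≡p))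
  isolated-unsuppress isol₂ e inc | no e≢e₁ | no e≢e₂ with Equivalence.from (R.ψ-img e) (e≢e₁ , e≢e₂)
  ... | f , ψf = isol₂ f (oldEdge-Inc ψf inc)

  SupStep-removeIsolated : (I : IsolatedLabel G x) →
                           SupStep (removeIsolated G x I) (removeIsolated G₂ x (IsolatedLabel-suppress I))
  SupStep-removeIsolated I = w′ , s′ , r′
    where
    Q  = removeIsolated G x I
    Q₂ = removeIsolated G₂ x (IsolatedLabel-suppress I)
    w′ = punchOut′ p w≢p
    s′ : Suppressible Q w′
    s′ = record
      { e₁    = S.e₁
      ; e₂    = S.e₂
      ; a     = punchOut′ p (isolated I S.e₁ ∘ SameEnds⇒Meets S.j₁ ∘ inj₂)
      ; b     = punchOut′ p (isolated I S.e₂ ∘ SameEnds⇒Meets S.j₂ ∘ inj₂)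
      ; e₁≢e₂ = S.e₁≢e₂
      ; j₁    = SameEnds-punchOut′ p S.j₁
      ; j₂    = SameEnds-punchOut′ p S.j₂
      ; a≢w   = S.a≢w ∘ punchOut′-injective p
      ; b≢w   = S.b≢w ∘ punchOut′-injective p
      ; deg2  = trans (deg-removeIsolated G x I w′) (trans (cong (deg G) (punchIn′-punchOut′ p w≢p)) S.deg2)
      ; unlab = λ (y , _) → S.unlab y ∘ punchOut′-injective p
      }
    φ-punchIn′ : ∀ {u} (u≢p₂ : u ≢ p₂) → R.φ (punchIn′ p₂ (punchOut′ p₂ u≢p₂)) ≡ R.φ u
    φ-punchIn′ u≢p₂ = cong R.φ (punchIn′-punchOut′ p₂ u≢p₂)
    φ′ : Fin (nV Q₂) → Fin (nV Q)
    φ′ z = punchOut′ p {R.φ (punchIn′ p₂ z)} (punchIn′≢p p₂ z ∘ R.φ-inj _ _ ∘ λ q → trans q (sym (R.labs x)))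
    image⇒≢w′ : ∀ u → (∃[ z ] φ′ z ≡ u) → u ≢ w′
    image⇒≢w′ u (z , φ′z≡u) u≡w′ =
      Equivalence.to (R.φ-img w) (punchIn′ p₂ z , punchOut′-injective p (trans φ′z≡u u≡w′)) refl
    ≢w′⇒image : ∀ u → u ≢ w′ → ∃[ z ] φ′ z ≡ u
    ≢w′⇒image u u≢w′ = punchOut′ p₂ v≢p₂ , ≡punchIn′⇒punchOut′≡ p (trans (φ-punchIn′ v≢p₂) φv≡u)
      where
      preimage = Equivalence.from (R.φ-img (punchIn′ p u)) (u≢w′ ∘ sym ∘ ≡punchIn′⇒punchOut′≡ p ∘ sym)
      v    = proj₁ preimage
      φv≡u = proj₂ preimage
      v≢p₂ : v ≢ p₂
      v≢p₂ q = punchIn′≢p p u (trans (sym φv≡u) (trans (cong R.φ q) (R.labs x)))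
    r′ : SuppressRes Q w′ s′ Q₂
    r′ = record
      { φ        = φ′
      ; φ-inj    = λ _ _ → punchIn′-injective p₂ ∘ R.φ-inj _ _ ∘ punchOut′-injective p
      ; φ-img    = λ u → mk⇔ (image⇒≢w′ u) (≢w′⇒image u)
      ; ψ        = R.ψ
      ; ψ-inj    = R.ψ-inj
      ; ψ-img    = R.ψ-img
      ; ψ-new    = R.ψ-new
      ; ends-old = λ f e ψf → punchOut′-cong p (trans (φ-punchIn′ _) (proj₁ (R.ends-old f e ψf)))
                            , punchOut′-cong p (trans (φ-punchIn′ _) (proj₂ (R.ends-old f e ψf)))
      ; ends-new = λ f ψf → SameEnds-punchOut′ p (SameEnds-substˡ (φ-punchIn′ _) (φ-punchIn′ _) (R.ends-new f ψf))
      ; labs     = λ (y , _) → punchOut′-cong p (trans (φ-punchIn′ _) (R.labs y))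
      }

Suppressions-removeIsolated : ∀ {k} {G P : MGraph (Fin k)} (x : Fin k) → Star SupStep G P → (I : IsolatedLabel G x) →
                              Σ (IsolatedLabel P x) λ IP → Star SupStep (removeIsolated G x I) (removeIsolated P x IP)
Suppressions-removeIsolated x ε I = I , ε
Suppressions-removeIsolated x ((w , s , r) ◅ steps) I
  with Suppressions-removeIsolated x steps (IsolatedLabel-suppress x s r I)
... | IP , steps′ = IP , (SupStep-removeIsolated x s r I ◅ steps′)

isolated-unsuppressAll : ∀ {k} {G P : MGraph (Fin k)} (x : Fin k) → Star SupStep G P →
                         (∀ f → ¬ Inc P f (lab P x)) → ∀ e → ¬ Inc G e (lab G x)
isolated-unsuppressAll x ε isol = isol
isolated-unsuppressAll x ((w , s , r) ◅ steps) isol = isolated-unsuppress x s r (isolated-unsuppressAll x steps isol)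

-- Deleting a leaf is deleting its pendant edge and then the isolated leaf

module _ {k : ℕ} {G H : MGraph (Fin k)} (x : Fin k) {e : Fin (nE G)} (D : EdgeDel G e H) where

  private
    module D = EdgeDel D
    to = Inverse.to D.φ

    Inc-EdgeDel : ∀ {f v} → Inc H f v → Inc G (D.ψ f) (to v)
    Inc-EdgeDel {f} inc = Meets-subst (proj₁ (D.ends f)) (proj₂ (D.ends f)) refl (Meets-map to inc)

  EdgeDel-unshared : (∀ y z → lab G y ≡ lab G z → y ≡ z) → ∀ y → y ≢ x → lab H y ≢ lab H x
  EdgeDel-unshared lab-inj y y≢x q = y≢x (lab-inj y x (trans (sym (D.labs y)) (trans (cong to q) (D.labs x))))

  EdgeDel-isolated : Leaf G (lab G x) → Inc G e (lab G x) → ∀ f → ¬ Inc H f (lab H x)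
  EdgeDel-isolated leaf e-inc f inc =
    Equivalence.to (D.ψ-img (D.ψ f)) (f , refl)
      (Leaf-Inc-unique G leaf (Meets-subst refl refl (D.labs x) (Inc-EdgeDel inc)) e-inc)

  EdgeDel-Inc : Connected G → ∀ v → v ≢ lab G x → (∀ f → ¬ Inc H f (lab H x)) → Inc G e (lab G x)
  EdgeDel-Inc conn v v≢p isol = go (conn (lab G x) v)
    where
    go : ReachIn G _ (lab G x) v → Inc G e (lab G x)
    go ε = ⊥-elim (v≢p refl)
    go ((e′ , _ , j) ◅ _) with e′ ≟ e
    ... | yes refl = Joins⇒Inc G j
    ... | no e′≢e with Equivalence.from (D.ψ-img e′) e′≢e
    ...   | f , refl = ⊥-elim (isol f (Meets-injective to (to-injective D.φ) (D.labs x)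
                        (Meets-subst (sym (proj₁ (D.ends f))) (sym (proj₂ (D.ends f))) refl (Joins⇒Inc G j))))

  EdgeDel-LeafDel : Inc G e (lab G x) → (I : IsolatedLabel H x) → LeafDel G x (removeIsolated H x I)
  EdgeDel-LeafDel e-inc I = record
    { φ     = to ∘ punchIn′ pH
    ; φ-inj = λ _ _ → punchIn′-injective pH ∘ to-injective D.φ
    ; φ-img = λ u → mk⇔ (image⇒≢p u) (≢p⇒image u)
    ; ψ     = D.ψ
    ; ψ-inj = D.ψ-inj
    ; ψ-img = λ e′ → mk⇔ (image⇒¬Inc e′) (¬Inc⇒image e′)
    ; ends  = λ f → trans (cong to (punchIn′-punchOut′ pH _)) (proj₁ (D.ends f))
                  , trans (cong to (punchIn′-punchOut′ pH _)) (proj₂ (D.ends f))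
    ; labs  = λ (y , _) → trans (cong to (punchIn′-punchOut′ pH _)) (D.labs y)
    }
    where
    pH = lab H x
    from = Inverse.from D.φ
    image⇒≢p : ∀ u → (∃[ z ] to (punchIn′ pH z) ≡ u) → u ≢ lab G x
    image⇒≢p u (z , q) r = punchIn′≢p pH z (to-injective D.φ (trans q (trans r (sym (D.labs x)))))
    ≢p⇒image : ∀ u → u ≢ lab G x → ∃[ z ] to (punchIn′ pH z) ≡ u
    ≢p⇒image u u≢p = punchOut′ pH from-u≢pH
                   , trans (cong to (punchIn′-punchOut′ pH from-u≢pH)) (Inverse.strictlyInverseˡ D.φ u)
      where
      from-u≢pH : from u ≢ pH
      from-u≢pH q = u≢p (trans (sym (Inverse.strictlyInverseˡ D.φ u)) (trans (cong to q) (D.labs x)))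
    image⇒¬Inc : ∀ e′ → (∃[ f ] D.ψ f ≡ e′) → ¬ Inc G e′ (lab G x)
    image⇒¬Inc e′ (f , refl) inc = isolated I f (Meets-injective to (to-injective D.φ) (D.labs x)
      (Meets-subst (sym (proj₁ (D.ends f))) (sym (proj₂ (D.ends f))) refl inc))
    ¬Inc⇒image : ∀ e′ → ¬ Inc G e′ (lab G x) → ∃[ f ] D.ψ f ≡ e′
    ¬Inc⇒image e′ ¬inc = Equivalence.from (D.ψ-img e′) λ { refl → ¬inc e-inc }

  EdgeDel-leafDeleted : Inc G e (lab G x) → (I : IsolatedLabel H x) → ∀ {P} → Suppress H P →
                        Σ (IsolatedLabel P x) λ IP → IsLeafDeleted G x (removeIsolated P x IP)
  EdgeDel-leafDeleted e-inc I (steps , fs) with Suppressions-removeIsolated x steps I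
  ... | IP , steps′ = IP , removeIsolated H x I , EdgeDel-LeafDel e-inc I , steps′
                         , FullySuppressed-removeIsolated _ x IP fs

image-all-but-one⇒suc≡ : ∀ {m n} (f : Fin m → Fin n) → (∀ a b → f a ≡ f b → a ≡ b) → (p : Fin n) →
                         (∀ u → (∃[ z ] f z ≡ u) ⇔ (u ≢ p)) → suc m ≡ n
image-all-but-one⇒suc≡ {m} {suc n} f f-inj p image =
  cong suc (≤-antisym (injective⇒≤ {f = g} g-inj) (injective⇒≤ {f = h} h-inj))
  where
  fz≢p : ∀ z → f z ≢ p
  fz≢p z = Equivalence.to (image (f z)) (z , refl)
  g : Fin m → Fin n
  g z = punchOut′ p (fz≢p z)
  g-inj : ∀ {a b} → g a ≡ g b → a ≡ b
  g-inj {a} {b} = f-inj a b ∘ punchOut′-injective p {i≢p = fz≢p a} {fz≢p b}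
  preimage : ∀ u → ∃[ z ] f z ≡ punchIn′ p u
  preimage u = Equivalence.from (image (punchIn′ p u)) (punchIn′≢p p u)
  h : Fin n → Fin m
  h = proj₁ ∘ preimage
  h-inj : ∀ {a b} → h a ≡ h b → a ≡ b
  h-inj {a} {b} q = punchIn′-injective p (trans (sym (proj₂ (preimage a))) (trans (cong f q) (proj₂ (preimage b))))

image-all-but-two⇒suc-suc≡ : ∀ {m n} (f : Fin m → Fin n) → (∀ a b → f a ≡ f b → a ≡ b) → (p q : Fin n) → q ≢ p →
                             (∀ u → (∃[ z ] f z ≡ u) ⇔ (u ≢ p × u ≢ q)) → suc (suc m) ≡ n
image-all-but-two⇒suc-suc≡ {m} {suc n} f f-inj p q q≢p image =
  cong suc (image-all-but-one⇒suc≡ g g-inj (punchOut′ p q≢p) image′)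
  where
  fz≢p : ∀ z → f z ≢ p
  fz≢p z = proj₁ (Equivalence.to (image (f z)) (z , refl))
  g : Fin m → Fin n
  g z = punchOut′ p (fz≢p z)
  g-inj : ∀ a b → g a ≡ g b → a ≡ b
  g-inj a b = f-inj a b ∘ punchOut′-injective p {i≢p = fz≢p a} {fz≢p b}
  image′ : ∀ u → (∃[ z ] g z ≡ u) ⇔ (u ≢ punchOut′ p q≢p)
  image′ u = mk⇔
    (λ (z , gz≡u) u≡q → proj₂ (Equivalence.to (image (f z)) (z , refl))
                                (punchOut′-injective p {i≢p = fz≢p z} {q≢p} (trans gz≡u u≡q)))
    (λ u≢q → let (z , fz≡u) = Equivalence.from (image (punchIn′ p u))
                                 (punchIn′≢p p u , u≢q ∘ sym ∘ ≡punchIn′⇒punchOut′≡ p {i≢p = q≢p} ∘ sym)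
             in z , ≡punchIn′⇒punchOut′≡ p {i≢p = fz≢p z} fz≡u)

fromMaybe : ∀ {n} → Maybe (Fin n) → Fin (suc n)
fromMaybe nothing  = zero
fromMaybe (just e) = suc e

fromMaybe-injective : ∀ {n} (a b : Maybe (Fin n)) → fromMaybe a ≡ fromMaybe b → a ≡ b
fromMaybe-injective nothing  nothing  _    = refl
fromMaybe-injective (just a) (just b) refl = refl

SupStep-size : ∀ {L} {G H : MGraph L} → SupStep G H → (suc (nV H) ≡ nV G) × (suc (nE H) ≡ nE G)
SupStep-size {G = G} {H} (w , s , r) =
    image-all-but-one⇒suc≡ R.φ R.φ-inj w R.φ-img
  , suc-injective (image-all-but-two⇒suc-suc≡ g g-inj (suc S.e₁) (suc S.e₂) (S.e₁≢e₂ ∘ sym ∘ Fin.suc-injective) image)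
  where
  module S = Suppressible s
  module R = SuppressRes r
  g : Fin (nE H) → Fin (suc (nE G))
  g = fromMaybe ∘ R.ψ
  g-inj : ∀ a b → g a ≡ g b → a ≡ b
  g-inj a b = R.ψ-inj a b ∘ fromMaybe-injective _ _
  image : ∀ u → (∃[ z ] g z ≡ u) ⇔ (u ≢ suc S.e₁ × u ≢ suc S.e₂)
  image zero    = mk⇔ (λ _ → (λ ()) , (λ ())) (λ _ → proj₁ R.ψ-new , cong fromMaybe (proj₂ R.ψ-new))
  image (suc e) = mk⇔ image⇒ ⇒image
    where
    image⇒ : (∃[ z ] g z ≡ suc e) → (suc e ≢ suc S.e₁ × suc e ≢ suc S.e₂)
    image⇒ (z , q) with R.ψ z in ψz
    image⇒ (z , refl) | just e′ =
      let (e≢e₁ , e≢e₂) = Equivalence.to (R.ψ-img e′) (z , ψz) in e≢e₁ ∘ Fin.suc-injective , e≢e₂ ∘ Fin.suc-injective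
    ⇒image : (suc e ≢ suc S.e₁ × suc e ≢ suc S.e₂) → ∃[ z ] g z ≡ suc e
    ⇒image (≢e₁ , ≢e₂) =
      let (z , ψz) = Equivalence.from (R.ψ-img e) (≢e₁ ∘ cong suc , ≢e₂ ∘ cong suc) in z , cong fromMaybe ψz

Suppressions-size : ∀ {L} {G P : MGraph L} → Star SupStep G P →
                    ∃[ s ] (nV G ≡ s + nV P) × (nE G ≡ s + nE P)
Suppressions-size ε = 0 , refl , refl
Suppressions-size (step ◅ steps) with Suppressions-size steps | SupStep-size step
... | s , v≡ , e≡ | sv , se = suc s , trans (sym sv) (cong suc v≡) , trans (sym se) (cong suc e≡)

EdgeDel-size : ∀ {L} {G H : MGraph L} {e} → EdgeDel G e H → (nV H ≡ nV G) × (suc (nE H) ≡ nE G)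
EdgeDel-size {e = e} D = ↔⇒≡ (EdgeDel.φ D) , image-all-but-one⇒suc≡ (EdgeDel.ψ D) (EdgeDel.ψ-inj D) e (EdgeDel.ψ-img D)

edgeDeleted-size : ∀ {L} {G P : MGraph L} {e} → IsEdgeDeleted G e P →
                   ∃[ s ] (nV G ≡ s + nV P) × (nE G ≡ suc (s + nE P))
edgeDeleted-size (_ , D , steps , _) with EdgeDel-size D | Suppressions-size steps
... | v≡ , e≡ | s , v≡′ , e≡′ = s , trans (sym v≡) v≡′ , trans (sym e≡) (cong suc e≡′)

nV-edgeDecks : ∀ {L} {G G′ P P′ : MGraph L} {e e′} → IsEdgeDeleted G e P → IsEdgeDeleted G′ e′ P′ →
               Equiv P′ P → nE G′ ≡ nE G → nV G′ ≡ nV G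
nV-edgeDecks {G = G} {G′} {P} {P′} deck deck′ P′≃P nE≡ with edgeDeleted-size deck | edgeDeleted-size deck′
... | s , v≡ , e≡ | s′ , v≡′ , e≡′ = begin
  nV G′          ≡⟨ v≡′ ⟩
  s′ + nV P′     ≡⟨ cong₂ _+_ s′≡s (↔⇒≡ (Equiv.φ P′≃P)) ⟩
  s + nV P       ≡⟨ sym v≡ ⟩
  nV G           ∎
  where
  open ≡-Reasoning
  s′≡s : s′ ≡ s
  s′≡s = +-cancelʳ-≡ (nE P) s′ s (suc-injective (begin
    suc (s′ + nE P)   ≡⟨ cong (λ n → suc (s′ + n)) (sym (↔⇒≡ (Equiv.ψ P′≃P))) ⟩
    suc (s′ + nE P′)  ≡⟨ sym e≡′ ⟩
    nE G′             ≡⟨ nE≡ ⟩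
    nE G              ≡⟨ e≡ ⟩
    suc (s + nE P)    ∎))

PhyloNet-vertex : ∀ {L} {G : MGraph L} → PhyloNet G → Fin (nV G)
PhyloNet-vertex (_ , _ , _ , T , T-contraction , 1≤nV , _) =
  proj₁ (BlobContraction.c-surj T-contraction (fromℕ< 1≤nV))

connected-isolated⇒≡ : ∀ {L} (G : MGraph L) → Connected G → ∀ {a} → (∀ e → ¬ Inc G e a) → ∀ u → u ≡ a
connected-isolated⇒≡ G conn {a} isol u with conn a u
... | ε                 = refl
... | (e , _ , j) ◅ _ = ⊥-elim (isol e (Joins⇒Inc G j))

all-equal⇒≡1 : ∀ {n} → Fin n → (∀ (u v : Fin n) → u ≡ v) → n ≡ 1
all-equal⇒≡1 {suc zero}    _ _   = refl
all-equal⇒≡1 {suc (suc n)} _ all with all zero (suc zero)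
... | ()

edgeless-PhyloNet-nV≡1 : ∀ {L} {G : MGraph L} → PhyloNet G → ¬ Fin (nE G) → nV G ≡ 1
edgeless-PhyloNet-nV≡1 {G = G} pn ¬edge = all-equal⇒≡1 v (λ u u′ → trans (≡v u) (sym (≡v u′)))
  where
  v  = PhyloNet-vertex pn
  ≡v = connected-isolated⇒≡ G (proj₁ (proj₂ pn)) {v} (λ e _ → ¬edge e)

≢⇒2≤ : ∀ {n} {a b : Fin n} → a ≢ b → 2 ≤ n
≢⇒2≤ {suc zero}    {zero} {zero} a≢b = ⊥-elim (a≢b refl)
≢⇒2≤ {suc (suc n)} _                 = s≤s (s≤s z≤n)

2≤⇒∃≢ : ∀ {n} → 2 ≤ n → (c : Fin n) → ∃[ d ] d ≢ c
2≤⇒∃≢ (s≤s (s≤s z≤n)) zero    = suc zero , λ ()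
2≤⇒∃≢ (s≤s (s≤s z≤n)) (suc c) = zero , λ ()

Fin-inhabited? : ∀ n → Fin n ⊎ ¬ Fin n
Fin-inhabited? zero    = inj₂ λ ()
Fin-inhabited? (suc n) = inj₁ zero

vertexless-Equiv : ∀ {L} {G H : MGraph L} → ¬ Fin (nV G) → ¬ Fin (nV H) → Equiv G H
vertexless-Equiv {G = G} {H} ¬vG ¬vH = record
  { φ    = mk↔ₛ′ (⊥-elim ∘ ¬vG) (⊥-elim ∘ ¬vH) (⊥-elim ∘ ¬vH) (⊥-elim ∘ ¬vG)
  ; ψ    = mk↔ₛ′ (⊥-elim ∘ ¬vG ∘ src G) (⊥-elim ∘ ¬vH ∘ src H) (⊥-elim ∘ ¬vH ∘ src H) (⊥-elim ∘ ¬vG ∘ src G)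
  ; ends = ⊥-elim ∘ ¬vG ∘ src G
  ; labs = ⊥-elim ∘ ¬vG ∘ lab G
  }

module _ {k : ℕ} {N N′ : MGraph (Fin k)} (pn : PhyloNet N) (β : Fin (nE N) ↔ Fin (nE N′))
         (er : EdgeReconstruction N N′ β) where

  private
    pn′     = proj₁ er
    decks   = proj₂ er
    simple  = proj₁ (proj₁ pn)
    conn    = proj₁ (proj₂ pn)
    conn′   = proj₁ (proj₂ pn′)
    lab-inj  = proj₁ (proj₁ (proj₂ (proj₂ pn)))
    lab-inj′ = proj₁ (proj₁ (proj₂ (proj₂ pn′)))
    leaves   = proj₂ (proj₁ (proj₂ (proj₂ pn)))

  edgeReconstruction-nV : nV N′ ≡ nV N
  edgeReconstruction-nV with Fin-inhabited? (nE N)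
  ... | inj₂ ¬edge =
    trans (edgeless-PhyloNet-nV≡1 pn′ (¬edge ∘ Inverse.from β)) (sym (edgeless-PhyloNet-nV≡1 pn ¬edge))
  ... | inj₁ e with decks e
  ... | _ , _ , deck′ , deck , P′≃P = nV-edgeDecks deck deck′ P′≃P (sym (↔⇒≡ β))

  LeafDecksAgree : Fin k → Set
  LeafDecksAgree x = ∃[ P′ ] ∃[ P ] (IsLeafDeleted N′ x P′ × IsLeafDeleted N x P × Equiv P′ P)

  pendant-leafDecksAgree : ∀ x e → Inc N e (lab N x) → LeafDecksAgree x
  pendant-leafDecksAgree x e e-inc with decks e
  ... | P′ , P , (H′ , D′ , sup′) , (H , D , sup) , P′≃P =
    removeIsolated P′ x IP′ , removeIsolated P x IP , leafDeck′ , leafDeck , Equiv-removeIsolated x IP′ IP P′≃P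
    where
    leaf = Equivalence.from (leaves (lab N x)) (x , refl)
    I : IsolatedLabel H x
    I = record { isolated = EdgeDel-isolated x D leaf e-inc ; unshared = EdgeDel-unshared x D lab-inj }
    IP       = proj₁ (EdgeDel-leafDeleted x D e-inc I sup)
    leafDeck = proj₂ (EdgeDel-leafDeleted x D e-inc I sup)
    I′ : IsolatedLabel H′ x
    I′ = record
      { isolated = isolated-unsuppressAll x (proj₁ sup′) (isolated-Equiv x P′≃P (isolated IP))
      ; unshared = EdgeDel-unshared x D′ lab-inj′
      }
    -- N′ has as many vertices as N, hence at least the two ends of e
    other = 2≤⇒∃≢ (subst (2 ≤_) (sym edgeReconstruction-nV) (≢⇒2≤ (simple e))) (lab N′ x)
    e-inc′ = EdgeDel-Inc x D′ conn′ (proj₁ other) (proj₂ other) (isolated I′)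
    IP′       = proj₁ (EdgeDel-leafDeleted x D′ e-inc′ I′ sup′)
    leafDeck′ = proj₂ (EdgeDel-leafDeleted x D′ e-inc′ I′ sup′)

  isolated-leafDecksAgree : ∀ x → (∀ e → ¬ Inc N e (lab N x)) → LeafDecksAgree x
  isolated-leafDecksAgree x isol =
      Q′ , Q , (Q′ , removeIsolated-LeafDel N′ x I′ , ε , ⊥-elim ∘ ¬vQ′)
    , (Q , removeIsolated-LeafDel N x I , ε , ⊥-elim ∘ ¬vQ) , vertexless-Equiv ¬vQ′ ¬vQ
    where
    ≡p : ∀ u → u ≡ lab N x
    ≡p = connected-isolated⇒≡ N conn isol
    ¬edge′ : ¬ Fin (nE N′)
    ¬edge′ e = isol (Inverse.from β e) (inj₁ (≡p _))
    ≡p′ : ∀ u → u ≡ lab N′ x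
    ≡p′ = connected-isolated⇒≡ N′ conn′ (λ e _ → ¬edge′ e)
    I : IsolatedLabel N x
    I = record { isolated = isol ; unshared = λ y y≢x → y≢x ∘ lab-inj y x }
    I′ : IsolatedLabel N′ x
    I′ = record { isolated = λ e _ → ¬edge′ e ; unshared = λ y y≢x → y≢x ∘ lab-inj′ y x }
    Q  = removeIsolated N x I
    Q′ = removeIsolated N′ x I′
    ¬vQ : ¬ Fin (nV Q)
    ¬vQ z = punchIn′≢p (lab N x) z (≡p _)
    ¬vQ′ : ¬ Fin (nV Q′)
    ¬vQ′ z = punchIn′≢p (lab N′ x) z (≡p′ _)

  edgeReconstruction-leafDecksAgree : ∀ x → LeafDecksAgree x
  edgeReconstruction-leafDecksAgree x with any? (λ e → Inc? N e (lab N x))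
  ... | yes (e , e-inc) = pendant-leafDecksAgree x e e-inc
  ... | no ¬inc         = isolated-leafDecksAgree x (λ e inc → ¬inc (e , inc))

  edgeReconstruction⇒leafReconstruction : LeafReconstruction N N′
  edgeReconstruction⇒leafReconstruction = pn′ , edgeReconstruction-nV , edgeReconstruction-leafDecksAgree

lemma9p1 : {k : ℕ} (N : MGraph (Fin k)) → PhyloNet N →
             LeafReconstructible N → EdgeReconstructible N
lemma9p1 N pn leafReconstructible N′ β er =
  leafReconstructible N′ (edgeReconstruction⇒leafReconstruction pn β er)
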